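{- Let $(\mathcal{E},\mathcal{M})$ be an f-regular category and suppose $f:X\to Y$ factors as $f=m\circ q$ with $q:X\to Q$ and $m:Q\to Y$, where $q\in\mathcal{M}^\bot$ and $\ker(f)\le\ker(q)$ as subobjects of $X\times X$. Then $m$ is a monomorphism.
   Context: An f-regular category is a pair $(\mathcal{E},\mathcal{M})$ where $\mathcal{E}$ has finite limits and $\mathcal{M}$ is a class of monomorphisms containing all isomorphisms and regular monomorphisms, closed under composition and under pullback, such that every arrow factors as $m\circ e$ with $m\in\mathcal{M}$ and $e\in\mathcal{M}^\bot$, where $\mathcal{M}^\bot$ is the class of arrows left orthogonal to every arrow of $\mathcal{M}$, and $\mathcal{M}^\bot$ is stable under pullback. For an arrow $g:X\to Z$, $\ker(g)$ denotes its kernel pair, viewed as a subobject of $X\times X$. -}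

module Defs where

open import Level using (Level; _⊔_; suc)
open import Data.Product using (Σ; ∃; _×_; _,_; proj₁; proj₂; ∃-syntax; Σ-syntax)
open import Relation.Binary using (Rel; IsEquivalence)

record Category (o ℓ e : Level) : Set (suc (o ⊔ ℓ ⊔ e)) where
  infixr 9 _∘_
  infix  4 _≈_
  field
    Obj   : Set o
    Hom   : Obj → Obj → Set ℓ
    _≈_   : ∀ {A B} → Rel (Hom A B) e
    equiv : ∀ {A B} → IsEquivalence (_≈_ {A} {B})
    id    : ∀ {A} → Hom A A
    _∘_   : ∀ {A B C} → Hom B C → Hom A B → Hom A C
    assoc : ∀ {A B C D} {f : Hom A B} {g : Hom B C} {h : Hom C D} →
            (h ∘ g) ∘ f ≈ h ∘ (g ∘ f)
    identityˡ : ∀ {A B} {f : Hom A B} → id ∘ f ≈ f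
    identityʳ : ∀ {A B} {f : Hom A B} → f ∘ id ≈ f
    ∘-resp-≈  : ∀ {A B C} {f h : Hom B C} {g i : Hom A B} →
                f ≈ h → g ≈ i → f ∘ g ≈ h ∘ i

module _ {o ℓ e : Level} (𝒞 : Category o ℓ e) where
  open Category 𝒞

  IsMono : ∀ {A B} → Hom A B → Set (o ⊔ ℓ ⊔ e)
  IsMono {A} m = ∀ {Z} (a b : Hom Z A) → m ∘ a ≈ m ∘ b → a ≈ b

  IsIso : ∀ {A B} → Hom A B → Set (ℓ ⊔ e)
  IsIso {A} {B} f = Σ[ g ∈ Hom B A ] (g ∘ f ≈ id × f ∘ g ≈ id)

  IsTerminal : Obj → Set (o ⊔ ℓ ⊔ e)
  IsTerminal T = ∀ A → Σ[ t ∈ Hom A T ] (∀ (t' : Hom A T) → t' ≈ t)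

  IsProduct : ∀ {A B P} → Hom P A → Hom P B → Set (o ⊔ ℓ ⊔ e)
  IsProduct {A} {B} {P} π₁ π₂ =
    ∀ {Z} (h₁ : Hom Z A) (h₂ : Hom Z B) →
      Σ[ u ∈ Hom Z P ] ((π₁ ∘ u ≈ h₁ × π₂ ∘ u ≈ h₂) ×
        (∀ (u' : Hom Z P) → π₁ ∘ u' ≈ h₁ → π₂ ∘ u' ≈ h₂ → u' ≈ u))

  IsPullback : ∀ {A B C P} → Hom A C → Hom B C → Hom P A → Hom P B → Set (o ⊔ ℓ ⊔ e)
  IsPullback {A} {B} {C} {P} f g p₁ p₂ =
    (f ∘ p₁ ≈ g ∘ p₂) ×
    (∀ {Z} (h₁ : Hom Z A) (h₂ : Hom Z B) → f ∘ h₁ ≈ g ∘ h₂ →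
      Σ[ u ∈ Hom Z P ] ((p₁ ∘ u ≈ h₁ × p₂ ∘ u ≈ h₂) ×
        (∀ (u' : Hom Z P) → p₁ ∘ u' ≈ h₁ → p₂ ∘ u' ≈ h₂ → u' ≈ u)))

  IsEqualizer : ∀ {E A B} → Hom E A → Hom A B → Hom A B → Set (o ⊔ ℓ ⊔ e)
  IsEqualizer {E} {A} {B} k f g =
    (f ∘ k ≈ g ∘ k) ×
    (∀ {Z} (h : Hom Z A) → f ∘ h ≈ g ∘ h →
      Σ[ u ∈ Hom Z E ] (k ∘ u ≈ h × (∀ (u' : Hom Z E) → k ∘ u' ≈ h → u' ≈ u)))

  IsRegularMono : ∀ {E A} → Hom E A → Set (o ⊔ ℓ ⊔ e)
  IsRegularMono {E} {A} k = Σ[ B ∈ Obj ] Σ[ f ∈ Hom A B ] Σ[ g ∈ Hom A B ] IsEqualizer k f g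

  record FiniteLimits : Set (o ⊔ ℓ ⊔ e) where
    field
      ⊤        : Obj
      ⊤-terminal : IsTerminal ⊤
      _×ₒ_     : Obj → Obj → Obj
      π₁       : ∀ {A B} → Hom (A ×ₒ B) A
      π₂       : ∀ {A B} → Hom (A ×ₒ B) B
      product  : ∀ {A B} → IsProduct (π₁ {A} {B}) π₂
      PB       : ∀ {A B C} → Hom A C → Hom B C → Obj
      pb₁      : ∀ {A B C} (f : Hom A C) (g : Hom B C) → Hom (PB f g) A
      pb₂      : ∀ {A B C} (f : Hom A C) (g : Hom B C) → Hom (PB f g) B
      pullback : ∀ {A B C} (f : Hom A C) (g : Hom B C) → IsPullback f g (pb₁ f g) (pb₂ f g)

    ⟨_,_⟩ : ∀ {Z A B} → Hom Z A → Hom Z B → Hom Z (A ×ₒ B)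
    ⟨ h₁ , h₂ ⟩ = proj₁ (product h₁ h₂)

    -- kernel pair of g : X → Z, as the (mono) arrow ker(g) → X × X
    KerObj : ∀ {X Z} → Hom X Z → Obj
    KerObj g = PB g g

    ker : ∀ {X Z} (g : Hom X Z) → Hom (KerObj g) (X ×ₒ X)
    ker g = ⟨ pb₁ g g , pb₂ g g ⟩

  -- order on subobjects of C (represented by arrows into C): m ≤ n iff m factors through n
  _≤ₛ_ : ∀ {A B C} → Hom A C → Hom B C → Set (ℓ ⊔ e)
  _≤ₛ_ {A} {B} m n = Σ[ h ∈ Hom A B ] (n ∘ h ≈ m)

  record ArrowClass (ℓM : Level) : Set (o ⊔ ℓ ⊔ e ⊔ suc ℓM) where
    field
      mem      : ∀ {A B} → Hom A B → Set ℓM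
      mem-resp-≈ : ∀ {A B} {f g : Hom A B} → f ≈ g → mem f → mem g

  _⊥_ : ∀ {A B C D} → Hom A B → Hom C D → Set (ℓ ⊔ e)
  _⊥_ {A} {B} {C} {D} e′ m =
    ∀ (u : Hom A C) (v : Hom B D) → m ∘ u ≈ v ∘ e′ →
      Σ[ d ∈ Hom B C ] ((d ∘ e′ ≈ u × m ∘ d ≈ v) ×
        (∀ (d' : Hom B C) → d' ∘ e′ ≈ u → m ∘ d' ≈ v → d' ≈ d))

  InLeftOrth : ∀ {ℓM} → ArrowClass ℓM → ∀ {A B} → Hom A B → Set (o ⊔ ℓ ⊔ e ⊔ ℓM)
  InLeftOrth M e′ = ∀ {C D} (m : Hom C D) → ArrowClass.mem M m → e′ ⊥ m

  record IsFRegular {ℓM : Level} (M : ArrowClass ℓM) : Set (o ⊔ ℓ ⊔ e ⊔ suc ℓM) where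
    open ArrowClass M using (mem)
    field
      finiteLimits : FiniteLimits
      M-mono   : ∀ {A B} (m : Hom A B) → mem m → IsMono m
      iso∈M    : ∀ {A B} (m : Hom A B) → IsIso m → mem m
      regMono∈M : ∀ {A B} (m : Hom A B) → IsRegularMono m → mem m
      M-∘      : ∀ {A B C} (m : Hom B C) (n : Hom A B) → mem m → mem n → mem (m ∘ n)
      M-pullback : ∀ {A B C P} (m : Hom A C) (g : Hom B C) (p₁ : Hom P A) (p₂ : Hom P B) →
                   IsPullback m g p₁ p₂ → mem m → mem p₂
      factor   : ∀ {A B} (f : Hom A B) →
                 Σ[ I ∈ Obj ] Σ[ m ∈ Hom I B ] Σ[ e′ ∈ Hom A I ]
                   (mem m × InLeftOrth M e′ × m ∘ e′ ≈ f)
      M⊥-pullback : ∀ {A B C P} (e′ : Hom A C) (g : Hom B C) (p₁ : Hom P A) (p₂ : Hom P B) →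
                   IsPullback e′ g p₁ p₂ → InLeftOrth M e′ → InLeftOrth M p₂

-- Arrows of M^⊥ are epimorphisms, being left orthogonal to the diagonals, which are regular monos.
-- Given m a ≈ m b, pulling q back along a and then along b ∘ p (p the first pullback of q) gives
-- an epimorphism ε = p ∘ r and arrows x, y with q x ≈ a ε and q y ≈ b ε. Then f x ≈ m a ε ≈ f y,
-- so (x, y) factors through ker f ≤ ker q; hence a ε ≈ q x ≈ q y ≈ b ε, and a ≈ b as ε is epi.
module Submission where

open import Defs
open import Level using (Level; _⊔_)
open import Data.Product using (_×_; _,_; proj₁; proj₂)
open import Relation.Binary using (Setoid; IsEquivalence)
import Relation.Binary.Reasoning.Setoid as SetoidReasoning

module CategoryReasoning {o ℓ e : Level} (𝒞 : Category o ℓ e) where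
  open Category 𝒞

  module ≈ {A B : Obj} = IsEquivalence (equiv {A} {B})

  hom-setoid : Obj → Obj → Setoid ℓ e
  hom-setoid A B = record { Carrier = Hom A B ; _≈_ = _≈_ ; isEquivalence = equiv }

  module HomReasoning {A B : Obj} = SetoidReasoning (hom-setoid A B)

  infixr 4 _⟩∘⟨_ refl⟩∘⟨_
  infixl 5 _⟩∘⟨refl

  _⟩∘⟨_ : ∀ {A B C} {f h : Hom B C} {g i : Hom A B} → f ≈ h → g ≈ i → f ∘ g ≈ h ∘ i
  _⟩∘⟨_ = ∘-resp-≈

  refl⟩∘⟨_ : ∀ {A B C} {f : Hom B C} {g i : Hom A B} → g ≈ i → f ∘ g ≈ f ∘ i
  refl⟩∘⟨ g≈i = ≈.refl ⟩∘⟨ g≈i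

  _⟩∘⟨refl : ∀ {A B C} {f h : Hom B C} {g : Hom A B} → f ≈ h → f ∘ g ≈ h ∘ g
  f≈h ⟩∘⟨refl = f≈h ⟩∘⟨ ≈.refl

  pullˡ : ∀ {A B C D} {f : Hom A B} {g : Hom B C} {h : Hom C D} {k : Hom B D} →
          h ∘ g ≈ k → h ∘ (g ∘ f) ≈ k ∘ f
  pullˡ h∘g≈k = ≈.trans (≈.sym assoc) (h∘g≈k ⟩∘⟨refl)

module _ {o ℓ e : Level} (𝒞 : Category o ℓ e) where
  open Category 𝒞

  IsEpi : ∀ {A B} → Hom A B → Set (o ⊔ ℓ ⊔ e)
  IsEpi {B = B} ε = ∀ {Z} (a b : Hom B Z) → a ∘ ε ≈ b ∘ ε → a ≈ b

  epi-∘ : ∀ {A B C} {ε₁ : Hom B C} {ε₂ : Hom A B} → IsEpi ε₁ → IsEpi ε₂ → IsEpi (ε₁ ∘ ε₂)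
  epi-∘ {ε₁ = ε₁} {ε₂} epi₁ epi₂ a b a∘ε≈b∘ε =
    epi₁ a b (epi₂ (a ∘ ε₁) (b ∘ ε₁) (≈.trans assoc (≈.trans a∘ε≈b∘ε (≈.sym assoc))))
    where open CategoryReasoning 𝒞

module WithFiniteLimits {o ℓ e : Level} {𝒞 : Category o ℓ e} (L : FiniteLimits 𝒞) where
  open Category 𝒞
  open FiniteLimits L
  open CategoryReasoning 𝒞

  π₁∘⟨⟩ : ∀ {Z A B} {h₁ : Hom Z A} {h₂ : Hom Z B} → π₁ ∘ ⟨ h₁ , h₂ ⟩ ≈ h₁
  π₁∘⟨⟩ {h₁ = h₁} {h₂} = proj₁ (proj₁ (proj₂ (product h₁ h₂)))

  π₂∘⟨⟩ : ∀ {Z A B} {h₁ : Hom Z A} {h₂ : Hom Z B} → π₂ ∘ ⟨ h₁ , h₂ ⟩ ≈ h₂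
  π₂∘⟨⟩ {h₁ = h₁} {h₂} = proj₂ (proj₁ (proj₂ (product h₁ h₂)))

  product-ext : ∀ {Z A B} {u v : Hom Z (A ×ₒ B)} → π₁ ∘ u ≈ π₁ ∘ v → π₂ ∘ u ≈ π₂ ∘ v → u ≈ v
  product-ext {u = u} {v} π₁-eq π₂-eq = ≈.trans (unique u π₁-eq π₂-eq) (≈.sym (unique v ≈.refl ≈.refl))
    where
    unique : ∀ w → π₁ ∘ w ≈ π₁ ∘ v → π₂ ∘ w ≈ π₂ ∘ v → w ≈ ⟨ π₁ ∘ v , π₂ ∘ v ⟩
    unique = proj₂ (proj₂ (product (π₁ ∘ v) (π₂ ∘ v)))

  ⟨⟩∘≈⟨⟩⇒₁ : ∀ {W Z A B} {a : Hom Z A} {b : Hom Z B} {c : Hom W A} {d : Hom W B} {h : Hom W Z} →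
             ⟨ a , b ⟩ ∘ h ≈ ⟨ c , d ⟩ → a ∘ h ≈ c
  ⟨⟩∘≈⟨⟩⇒₁ eq = ≈.trans (≈.sym (pullˡ π₁∘⟨⟩)) (≈.trans (refl⟩∘⟨ eq) π₁∘⟨⟩)

  ⟨⟩∘≈⟨⟩⇒₂ : ∀ {W Z A B} {a : Hom Z A} {b : Hom Z B} {c : Hom W A} {d : Hom W B} {h : Hom W Z} →
             ⟨ a , b ⟩ ∘ h ≈ ⟨ c , d ⟩ → b ∘ h ≈ d
  ⟨⟩∘≈⟨⟩⇒₂ eq = ≈.trans (≈.sym (pullˡ π₂∘⟨⟩)) (≈.trans (refl⟩∘⟨ eq) π₂∘⟨⟩)

  δ : ∀ {A} → Hom A (A ×ₒ A)
  δ = ⟨ id , id ⟩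

  δ-isEqualizer : ∀ {A} → IsEqualizer 𝒞 (δ {A}) π₁ π₂
  δ-isEqualizer = ≈.trans π₁∘⟨⟩ (≈.sym π₂∘⟨⟩) , λ h π₁∘h≈π₂∘h →
      π₁ ∘ h
    , product-ext (≈.trans (pullˡ π₁∘⟨⟩) identityˡ)
                  (≈.trans (pullˡ π₂∘⟨⟩) (≈.trans identityˡ π₁∘h≈π₂∘h))
    , λ u δ∘u≈h → ≈.trans (≈.sym identityˡ) (≈.trans (≈.sym (pullˡ π₁∘⟨⟩)) (refl⟩∘⟨ δ∘u≈h))

  factors-through-δ⇒≈ : ∀ {Z A} {a b d : Hom Z A} → δ ∘ d ≈ ⟨ a , b ⟩ → a ≈ b
  factors-through-δ⇒≈ δ∘d≈⟨a,b⟩ =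
    ≈.trans (≈.sym (⟨⟩∘≈⟨⟩⇒₁ δ∘d≈⟨a,b⟩)) (⟨⟩∘≈⟨⟩⇒₂ δ∘d≈⟨a,b⟩)

  ⊥δ⇒epi : ∀ {W Z} {ε : Hom W Z} → (∀ {A} → _⊥_ 𝒞 ε (δ {A})) → IsEpi 𝒞 ε
  ⊥δ⇒epi {ε = ε} ε⊥δ a b a∘ε≈b∘ε =
    factors-through-δ⇒≈ (proj₂ (proj₁ (proj₂ (ε⊥δ (a ∘ ε) ⟨ a , b ⟩ square))))
    where
    square : δ ∘ (a ∘ ε) ≈ ⟨ a , b ⟩ ∘ ε
    square = product-ext (≈.trans (pullˡ π₁∘⟨⟩) (≈.trans identityˡ (≈.sym (pullˡ π₁∘⟨⟩))))
                         (≈.trans (pullˡ π₂∘⟨⟩) (≈.trans identityˡ (≈.trans a∘ε≈b∘ε (≈.sym (pullˡ π₂∘⟨⟩)))))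

  ker-≤⇒equalises : ∀ {X Y Q W} {f : Hom X Y} {q : Hom X Q} {x y : Hom W X} →
                    _≤ₛ_ 𝒞 (ker f) (ker q) → f ∘ x ≈ f ∘ y → q ∘ x ≈ q ∘ y
  ker-≤⇒equalises {W = W} {f = f} {q} {x} {y} (h , ker-q∘h≈ker-f) f∘x≈f∘y = begin
      q ∘ x                 ≈⟨ refl⟩∘⟨ ≈.sym k₁ ⟩
      q ∘ (pb₁ q q ∘ h ∘ u) ≈⟨ pullˡ (proj₁ (pullback q q)) ⟩
      (q ∘ pb₂ q q) ∘ h ∘ u ≈⟨ assoc ⟩
      q ∘ (pb₂ q q ∘ h ∘ u) ≈⟨ refl⟩∘⟨ k₂ ⟩
      q ∘ y                 ∎
    where
    open HomReasoning
    u : Hom W (KerObj f)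
    u = proj₁ (proj₂ (pullback f f) x y f∘x≈f∘y)
    u-factors : pb₁ f f ∘ u ≈ x × pb₂ f f ∘ u ≈ y
    u-factors = proj₁ (proj₂ (proj₂ (pullback f f) x y f∘x≈f∘y))
    k₁ : pb₁ q q ∘ h ∘ u ≈ x
    k₁ = ≈.trans (pullˡ (⟨⟩∘≈⟨⟩⇒₁ ker-q∘h≈ker-f)) (proj₁ u-factors)
    k₂ : pb₂ q q ∘ h ∘ u ≈ y
    k₂ = ≈.trans (pullˡ (⟨⟩∘≈⟨⟩⇒₂ ker-q∘h≈ker-f)) (proj₂ u-factors)

  lifts-equalise : ∀ {X Y Q Z W} {f : Hom X Y} {q : Hom X Q} {m : Hom Q Y} {a b : Hom Z Q}
                   {g : Hom W Z} {x y : Hom W X} →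
                   f ≈ m ∘ q → _≤ₛ_ 𝒞 (ker f) (ker q) → m ∘ a ≈ m ∘ b →
                   q ∘ x ≈ a ∘ g → q ∘ y ≈ b ∘ g → a ∘ g ≈ b ∘ g
  lifts-equalise {f = f} {q} {m} {a} {b} {g} {x} {y} f≈m∘q ker-f≤ker-q m∘a≈m∘b q∘x≈a∘g q∘y≈b∘g = begin
      a ∘ g ≈⟨ ≈.sym q∘x≈a∘g ⟩
      q ∘ x ≈⟨ ker-≤⇒equalises ker-f≤ker-q f∘x≈f∘y ⟩
      q ∘ y ≈⟨ q∘y≈b∘g ⟩
      b ∘ g ∎
    where
    open HomReasoning
    f∘x≈f∘y : f ∘ x ≈ f ∘ y
    f∘x≈f∘y = begin
      f ∘ x       ≈⟨ ≈.trans (f≈m∘q ⟩∘⟨refl) assoc ⟩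
      m ∘ (q ∘ x) ≈⟨ refl⟩∘⟨ q∘x≈a∘g ⟩
      m ∘ (a ∘ g) ≈⟨ ≈.trans (pullˡ m∘a≈m∘b) assoc ⟩
      m ∘ (b ∘ g) ≈⟨ refl⟩∘⟨ ≈.sym q∘y≈b∘g ⟩
      m ∘ (q ∘ y) ≈⟨ ≈.sym (≈.trans (f≈m∘q ⟩∘⟨refl) assoc) ⟩
      f ∘ y       ∎

module WithFRegular {o ℓ e ℓM : Level} {𝒞 : Category o ℓ e} {M : ArrowClass 𝒞 ℓM}
                    (F : IsFRegular 𝒞 M) where
  open Category 𝒞
  open IsFRegular F
  open FiniteLimits finiteLimits
  open WithFiniteLimits finiteLimits

  M⊥⇒epi : ∀ {W Z} {ε : Hom W Z} → InLeftOrth 𝒞 M ε → IsEpi 𝒞 ε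
  M⊥⇒epi ε∈M⊥ = ⊥δ⇒epi (λ {A} → ε∈M⊥ δ (regMono∈M δ (A , π₁ , π₂ , δ-isEqualizer)))

  pullback-cover : ∀ {X Q Z} {q : Hom X Q} → InLeftOrth 𝒞 M q → (a : Hom Z Q) →
                   IsEpi 𝒞 (pb₂ q a) × q ∘ pb₁ q a ≈ a ∘ pb₂ q a
  pullback-cover {q = q} q∈M⊥ a =
    M⊥⇒epi (M⊥-pullback q a (pb₁ q a) (pb₂ q a) (pullback q a) q∈M⊥) , proj₁ (pullback q a)

mainTheorem5 : ∀ {o ℓ e ℓM : Level} (𝒞 : Category o ℓ e) (M : ArrowClass 𝒞 ℓM)
                 (F : IsFRegular 𝒞 M) →
               let open Category 𝒞
                   open FiniteLimits (IsFRegular.finiteLimits F)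
               in ∀ {X Y Q : Obj} (f : Hom X Y) (q : Hom X Q) (m : Hom Q Y) →
                  f ≈ m ∘ q →
                  InLeftOrth 𝒞 M q →
                  _≤ₛ_ 𝒞 (ker f) (ker q) →
                  IsMono 𝒞 m
mainTheorem5 𝒞 M F {X} f q m f≈m∘q q∈M⊥ ker-f≤ker-q {Z} a b m∘a≈m∘b =
  epi-∘ 𝒞 p-epi r-epi a b
    (lifts-equalise f≈m∘q ker-f≤ker-q m∘a≈m∘b
      (≈.trans (pullˡ q∘x≈a∘p) assoc) (≈.trans q∘y≈b∘p∘r assoc))
  where
  open Category 𝒞
  open FiniteLimits (IsFRegular.finiteLimits F)
  open CategoryReasoning 𝒞
  open WithFiniteLimits (IsFRegular.finiteLimits F)
  open WithFRegular F
  p : Hom (PB q a) Z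
  p = pb₂ q a
  x : Hom (PB q a) X
  x = pb₁ q a
  r : Hom (PB q (b ∘ p)) (PB q a)
  r = pb₂ q (b ∘ p)
  y : Hom (PB q (b ∘ p)) X
  y = pb₁ q (b ∘ p)
  p-epi : IsEpi 𝒞 p
  p-epi = proj₁ (pullback-cover q∈M⊥ a)
  r-epi : IsEpi 𝒞 r
  r-epi = proj₁ (pullback-cover q∈M⊥ (b ∘ p))
  q∘x≈a∘p : q ∘ x ≈ a ∘ p
  q∘x≈a∘p = proj₂ (pullback-cover q∈M⊥ a)
  q∘y≈b∘p∘r : q ∘ y ≈ (b ∘ p) ∘ r
  q∘y≈b∘p∘r = proj₂ (pullback-cover q∈M⊥ (b ∘ p))
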